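{- Let $f$ and $g$ be $k$-functions on $Q_n$. Then $$ h = \left(\frac{f+g}{2} \right) x_{n+1} + \left(\frac{f-g}{2} \right) x_{n+2}, $$ viewed as a function of $(x_1,\dots,x_{n+2})\in\{ -1,1\}^{n+2}$ (with $f,g$ evaluated at $(x_1,\dots,x_n)$), is a $(k+1)$-function on $Q_{n+2}$.
   Context: $Q_n$ is the $n$-dimensional Boolean hypercube with vertex set $\{ -1,1\}^n$, two vertices being adjacent iff they differ in exactly one coordinate; $\Gamma(x)$ denotes the neighbourhood of $x$. A Boolean function on $Q_n$ is a function $f:\{ -1,1\}^n\to\{ -1,1\}$. A $k$-function is a Boolean function $f$ on $Q_n$ such that for every vertex $v$, $|\{w\in\Gamma(v): f(v)\neq f(w)\}|=k$. -}

module Defs where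

open import Data.Nat using (ℕ; suc)
open import Data.Fin using (Fin)
open import Data.Vec using (Vec; updateAt; lookup)
open import Data.Integer using (ℤ; +_; -[1+_])
open import Data.List using (List; length; filter)
open import Data.List.Base using ()
open import Relation.Binary.PropositionalEquality using (_≡_)
open import Relation.Nullary using (¬_)
open import Relation.Nullary.Decidable using (¬?)

data Sign : Set where
  plus minus : Sign

⟦_⟧ : Sign → ℤ
⟦ plus ⟧ = + 1
⟦ minus ⟧ = -[1+ 0 ]

neg : Sign → Sign
neg plus = minus
neg minus = plus

_≟ₛ_ : (a b : Sign) → Relation.Nullary.Dec (a ≡ b)
plus ≟ₛ plus = Relation.Nullary.yes Relation.Binary.PropositionalEquality.refl
plus ≟ₛ minus = Relation.Nullary.no (λ ())
minus ≟ₛ plus = Relation.Nullary.no (λ ())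
minus ≟ₛ minus = Relation.Nullary.yes Relation.Binary.PropositionalEquality.refl

Cube : ℕ → Set
Cube n = Vec Sign n

BoolFun : ℕ → Set
BoolFun n = Cube n → Sign

flip : ∀ {n} → Fin n → Cube n → Cube n
flip i v = updateAt v i neg

sensitivity : ∀ {n} → BoolFun n → Cube n → ℕ
sensitivity {n} f v =
  length (filter (λ i → ¬? (f v ≟ₛ f (flip i v))) (Data.List.Base.allFin n))

IsKFunction : ∀ {n} → ℕ → BoolFun n → Set
IsKFunction {n} k f = (v : Cube n) → sensitivity f v ≡ k

-- Put h(x, a, b) = a · f x when a = b and h(x, a, b) = a · g x when a ≠ b: this is the formula
-- of the statement, as one of (f ± g)/2 vanishes and the other equals f. Flipping a coordinate
-- of x keeps (a, b), so h changes along it exactly when f (on the diagonal) or g (off it) does: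
-- k directions. Of the flips of a and b, one turns a · f x into a · g x and the other into
-- −a · g x (f and g exchanged off the diagonal), and exactly one of these differs from a · f x.
module Submission where

open import Defs
open import Data.Nat using (ℕ; zero; suc; _+_)
open import Data.Nat.Properties using (+-comm)
open import Data.Vec using (Vec; _++_; _∷_; []; take; drop)
open import Data.Vec.Properties using (take++drop≡id; ++-injective)
open import Data.Integer using () renaming (_+_ to _+ℤ_; _*_ to _*ℤ_; _-_ to _-ℤ_)
open import Data.Fin using (Fin; _↑ˡ_; _↑ʳ_) renaming (zero to fzero; suc to fsuc)
open import Data.List as List using (length; filter; tabulate; allFin)
open import Data.List.Properties using (filter-++; filter-≐; length-++; map-tabulate)
open import Data.Bool using (true; false; if_then_else_)
open import Data.Product using (Σ; _×_; _,_; proj₁; proj₂)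
open import Function using (_∘_; id; _⇔_; mk⇔; Equivalence)
open import Function.Definitions using (Injective)
open import Relation.Binary.PropositionalEquality
  using (_≡_; _≗_; refl; sym; trans; cong; cong₂; module ≡-Reasoning)
open import Relation.Nullary using (does)
open import Relation.Nullary.Decidable using (¬?)
open import Relation.Unary using (Pred; Decidable)

tabulate-++ : ∀ {n m a} {A : Set a} (t : Fin (n + m) → A) →
  tabulate t ≡ tabulate (t ∘ (_↑ˡ m)) List.++ tabulate (t ∘ (n ↑ʳ_))
tabulate-++ {zero} t = refl
tabulate-++ {suc n} {m} t = cong (t fzero List.∷_) (tabulate-++ {n} {m} (t ∘ fsuc))

length-filter-map : ∀ {a b p} {A : Set a} {B : Set b} {P : Pred B p} (P? : Decidable P)
  (g : A → B) (xs : List.List A) →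
  length (filter P? (List.map g xs)) ≡ length (filter (P? ∘ g) xs)
length-filter-map P? g List.[] = refl
length-filter-map P? g (x List.∷ xs) with does (P? (g x))
... | true = cong suc (length-filter-map P? g xs)
... | false = length-filter-map P? g xs

length-filter-allFin-++ : ∀ {n m p} {P : Pred (Fin (n + m)) p} (P? : Decidable P) →
  length (filter P? (allFin (n + m)))
    ≡ length (filter (P? ∘ (_↑ˡ m)) (allFin n)) + length (filter (P? ∘ (n ↑ʳ_)) (allFin m))
length-filter-allFin-++ {n} {m} P? = begin
  length (filter P? (allFin (n + m)))
    ≡⟨ cong (length ∘ filter P?) (tabulate-++ {n} {m} id) ⟩
  length (filter P? (tabulate (_↑ˡ m) List.++ tabulate (n ↑ʳ_)))
    ≡⟨ cong length (filter-++ P? (tabulate (_↑ˡ m)) _) ⟩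
  length (filter P? (tabulate (_↑ˡ m)) List.++ filter P? (tabulate (n ↑ʳ_)))
    ≡⟨ length-++ (filter P? (tabulate (_↑ˡ m))) ⟩
  length (filter P? (tabulate (_↑ˡ m))) + length (filter P? (tabulate (n ↑ʳ_)))
    ≡⟨ cong₂ _+_ (along (_↑ˡ m)) (along (n ↑ʳ_)) ⟩
  length (filter (P? ∘ (_↑ˡ m)) (allFin n)) + length (filter (P? ∘ (n ↑ʳ_)) (allFin m)) ∎
  where
  open ≡-Reasoning
  along : ∀ {k} (g : Fin k → Fin (n + m)) →
    length (filter P? (tabulate g)) ≡ length (filter (P? ∘ g) (allFin k))
  along g = trans (cong (length ∘ filter P?) (sym (map-tabulate id g))) (length-filter-map P? g (allFin _))

flip-↑ˡ : ∀ {n m} (i : Fin n) (x : Cube n) (y : Cube m) → flip (i ↑ˡ m) (x ++ y) ≡ flip i x ++ y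
flip-↑ˡ fzero (s ∷ x) y = refl
flip-↑ˡ (fsuc i) (s ∷ x) y = cong (s ∷_) (flip-↑ˡ i x y)

flip-↑ʳ : ∀ {n m} (j : Fin m) (x : Cube n) (y : Cube m) → flip (n ↑ʳ j) (x ++ y) ≡ x ++ flip j y
flip-↑ʳ j [] y = refl
flip-↑ʳ j (s ∷ x) y = cong (s ∷_) (flip-↑ʳ j x y)

take-++ : ∀ {a} {A : Set a} {n m} (x : Vec A n) (y : Vec A m) → take n (x ++ y) ≡ x
take-++ {n = n} x y = proj₁ (++-injective (take n (x ++ y)) x (take++drop≡id n (x ++ y)))

drop-++ : ∀ {a} {A : Set a} {n m} (x : Vec A n) (y : Vec A m) → drop n (x ++ y) ≡ y
drop-++ {n = n} x y = proj₂ (++-injective (take n (x ++ y)) x (take++drop≡id n (x ++ y)))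

length-filter-≢ : ∀ {n} (a : Sign) (b : Fin n → Sign) (a′ : Sign) (b′ : Fin n → Sign) →
  (∀ i → a ≡ b i ⇔ a′ ≡ b′ i) →
  length (filter (λ i → ¬? (a ≟ₛ b i)) (allFin n)) ≡ length (filter (λ i → ¬? (a′ ≟ₛ b′ i)) (allFin n))
length-filter-≢ {n} a b a′ b′ a≡b⇔a′≡b′ = cong length (filter-≐
  (λ i → ¬? (a ≟ₛ b i)) (λ i → ¬? (a′ ≟ₛ b′ i))
  ( (λ {i} a≢b a′≡b′ → a≢b (Equivalence.from (a≡b⇔a′≡b′ i) a′≡b′))
  , (λ {i} a′≢b′ a≡b → a′≢b′ (Equivalence.to (a≡b⇔a′≡b′ i) a≡b)) )
  (allFin n))

sensitivity-resp : ∀ {n} (F : BoolFun n) (v : Cube n) (G : BoolFun n) (w : Cube n) →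
  (∀ i → F v ≡ F (flip i v) ⇔ G w ≡ G (flip i w)) → sensitivity F v ≡ sensitivity G w
sensitivity-resp F v G w = length-filter-≢ (F v) (λ i → F (flip i v)) (G w) (λ i → G (flip i w))

sensitivity-cong : ∀ {n} {F G : BoolFun n} → F ≗ G → (v : Cube n) → sensitivity F v ≡ sensitivity G v
sensitivity-cong {F = F} {G} F≗G v = sensitivity-resp F v G v λ i →
  mk⇔ (λ e → trans (sym (F≗G v)) (trans e (F≗G (flip i v))))
      (λ e → trans (F≗G v) (trans e (sym (F≗G (flip i v)))))

sensitivity-∘ : ∀ {n} {σ : Sign → Sign} → Injective _≡_ _≡_ σ → (F : BoolFun n) (v : Cube n) →
  sensitivity (σ ∘ F) v ≡ sensitivity F v
sensitivity-∘ {σ = σ} σ-inj F v = sensitivity-resp (σ ∘ F) v F v λ i → mk⇔ σ-inj (cong σ)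

sensitivity-++ : ∀ {n m} (F : BoolFun (n + m)) (x : Cube n) (y : Cube m) →
  sensitivity F (x ++ y) ≡ sensitivity (λ x′ → F (x′ ++ y)) x + sensitivity (λ y′ → F (x ++ y′)) y
sensitivity-++ {n} {m} F x y = trans
  (length-filter-allFin-++ {n} {m} (λ i → ¬? (F (x ++ y) ≟ₛ F (flip i (x ++ y)))))
  (cong₂ _+_ (length-filter-≢ _ _ _ _ λ i → ≡-rewriteʳ (cong F (flip-↑ˡ i x y)))
             (length-filter-≢ _ _ _ _ λ j → ≡-rewriteʳ (cong F (flip-↑ʳ j x y))))
  where
  ≡-rewriteʳ : ∀ {a b c : Sign} → b ≡ c → a ≡ b ⇔ a ≡ c
  ≡-rewriteʳ b≡c = mk⇔ (λ e → trans e b≡c) (λ e → trans e (sym b≡c))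

uncurry++ : ∀ {n m} → (Cube n → Cube m → Sign) → BoolFun (n + m)
uncurry++ {n} H v = H (take n v) (drop n v)

uncurry++-++ : ∀ {n m} (H : Cube n → Cube m → Sign) (x : Cube n) (y : Cube m) →
  uncurry++ H (x ++ y) ≡ H x y
uncurry++-++ H x y = cong₂ H (take-++ x y) (drop-++ x y)

sensitivity-uncurry++ : ∀ {n m} (H : Cube n → Cube m → Sign) (x : Cube n) (y : Cube m) →
  sensitivity (uncurry++ H) (x ++ y) ≡ sensitivity (λ x′ → H x′ y) x + sensitivity (H x) y
sensitivity-uncurry++ H x y = trans (sensitivity-++ (uncurry++ H) x y)
  (cong₂ _+_ (sensitivity-cong (λ x′ → uncurry++-++ H x′ y) x)
             (sensitivity-cong (uncurry++-++ H x) y))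

_·_ : Sign → Sign → Sign
plus · s = s
minus · s = neg s

·-cancelˡ : ∀ a → Injective _≡_ _≡_ (a ·_)
·-cancelˡ plus e = e
·-cancelˡ minus {plus} {plus} e = refl
·-cancelˡ minus {minus} {minus} e = refl

mix : Sign → Sign → BoolFun 2
mix s t (a ∷ b ∷ []) = a · (if does (a ≟ₛ b) then s else t)

mix-double : ∀ s t a b →
  ⟦ mix s t (a ∷ b ∷ []) ⟧ +ℤ ⟦ mix s t (a ∷ b ∷ []) ⟧ ≡ ((⟦ s ⟧ +ℤ ⟦ t ⟧) *ℤ ⟦ a ⟧) +ℤ ((⟦ s ⟧ -ℤ ⟦ t ⟧) *ℤ ⟦ b ⟧)
mix-double plus plus plus plus = refl
mix-double plus plus plus minus = refl
mix-double plus plus minus plus = refl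
mix-double plus plus minus minus = refl
mix-double plus minus plus plus = refl
mix-double plus minus plus minus = refl
mix-double plus minus minus plus = refl
mix-double plus minus minus minus = refl
mix-double minus plus plus plus = refl
mix-double minus plus plus minus = refl
mix-double minus plus minus plus = refl
mix-double minus plus minus minus = refl
mix-double minus minus plus plus = refl
mix-double minus minus plus minus = refl
mix-double minus minus minus plus = refl
mix-double minus minus minus minus = refl

mix-is-1-function : ∀ s t → IsKFunction 1 (mix s t)
mix-is-1-function plus plus (plus ∷ plus ∷ []) = refl
mix-is-1-function plus plus (plus ∷ minus ∷ []) = refl
mix-is-1-function plus plus (minus ∷ plus ∷ []) = refl
mix-is-1-function plus plus (minus ∷ minus ∷ []) = refl
mix-is-1-function plus minus (plus ∷ plus ∷ []) = refl
mix-is-1-function plus minus (plus ∷ minus ∷ []) = refl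
mix-is-1-function plus minus (minus ∷ plus ∷ []) = refl
mix-is-1-function plus minus (minus ∷ minus ∷ []) = refl
mix-is-1-function minus plus (plus ∷ plus ∷ []) = refl
mix-is-1-function minus plus (plus ∷ minus ∷ []) = refl
mix-is-1-function minus plus (minus ∷ plus ∷ []) = refl
mix-is-1-function minus plus (minus ∷ minus ∷ []) = refl
mix-is-1-function minus minus (plus ∷ plus ∷ []) = refl
mix-is-1-function minus minus (plus ∷ minus ∷ []) = refl
mix-is-1-function minus minus (minus ∷ plus ∷ []) = refl
mix-is-1-function minus minus (minus ∷ minus ∷ []) = refl

sensitivity-mix-restriction : ∀ {n k} {f g : BoolFun n} → IsKFunction k f → IsKFunction k g →
  (y : Cube 2) (x : Cube n) → sensitivity (λ x′ → mix (f x′) (g x′) y) x ≡ k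
sensitivity-mix-restriction {f = f} {g} kf kg (a ∷ b ∷ []) x with does (a ≟ₛ b)
... | true = trans (sensitivity-∘ (·-cancelˡ a) f x) (kf x)
... | false = trans (sensitivity-∘ (·-cancelˡ a) g x) (kg x)

lemma7 : (n k : ℕ) (f g : BoolFun n) → IsKFunction k f → IsKFunction k g →
    Σ (BoolFun (n + 2)) λ h →
      ((x : Cube n) (a b : Sign) →
        ⟦ h (x ++ a ∷ b ∷ []) ⟧ +ℤ ⟦ h (x ++ a ∷ b ∷ []) ⟧
          ≡ ((⟦ f x ⟧ +ℤ ⟦ g x ⟧) *ℤ ⟦ a ⟧) +ℤ ((⟦ f x ⟧ -ℤ ⟦ g x ⟧) *ℤ ⟦ b ⟧))
      × IsKFunction (suc k) h
lemma7 n k f g kf kg = h , h-double , h-sensitivity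
  where
  H : Cube n → Cube 2 → Sign
  H x = mix (f x) (g x)

  h : BoolFun (n + 2)
  h = uncurry++ H

  h-double : ∀ x a b → ⟦ h (x ++ a ∷ b ∷ []) ⟧ +ℤ ⟦ h (x ++ a ∷ b ∷ []) ⟧
                      ≡ ((⟦ f x ⟧ +ℤ ⟦ g x ⟧) *ℤ ⟦ a ⟧) +ℤ ((⟦ f x ⟧ -ℤ ⟦ g x ⟧) *ℤ ⟦ b ⟧)
  h-double x a b = trans (cong (λ s → ⟦ s ⟧ +ℤ ⟦ s ⟧) (uncurry++-++ H x (a ∷ b ∷ [])))
                         (mix-double (f x) (g x) a b)

  h-sensitivity : IsKFunction (suc k) h
  h-sensitivity v = begin
    sensitivity h v                           ≡⟨ cong (sensitivity h) (sym (take++drop≡id n v)) ⟩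
    sensitivity h (x ++ y)                    ≡⟨ sensitivity-uncurry++ H x y ⟩
    sensitivity (λ x′ → H x′ y) x + sensitivity (H x) y
      ≡⟨ cong₂ _+_ (sensitivity-mix-restriction kf kg y x) (mix-is-1-function (f x) (g x) y) ⟩
    k + 1                                     ≡⟨ +-comm k 1 ⟩
    suc k                                     ∎
    where
    open ≡-Reasoning
    x = take n v
    y = drop n v
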